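{- Let $F$ be a totally real field, $E \subseteq F$ a subfield, $G = \operatorname{Res}_{F/E}\operatorname{GL}_2$ and $G^* = G \times_{\operatorname{Res}_{F/E}\operatorname{GL}_1} \operatorname{GL}_1$. Let $\Pi$ be the automorphic representation of $G(\mathbf{A}_E) = \operatorname{GL}_2(\mathbf{A}_F)$ given by a Hilbert modular form over $F$ of weight $(\underline{k}, \underline{t})$, and for a real place $\tau$ of $E$ let $\lambda_\tau$ be the Harish–Chandra parameter of $\Pi_\tau$ and $\lambda_\tau^*$ its projection to $X_\bullet(\hat T^*) \otimes \mathbf{C}$. Then $\lambda_\tau^*$ lies in the integral cocharacter lattice $X_\bullet(\hat T^*)$ if and only if $\sum_{\sigma \mid \tau}(t_\sigma - \tfrac12) \in \mathbf{Z}$.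
   Context: $\Sigma_F$ is the set of real embeddings of $F$; for a real place $\tau$ of $E$, "$\sigma \mid \tau$" means $\sigma \in \Sigma_F$ restricts to $\tau$ on $E$. A weight is a pair $(\underline k, \underline t)$ with $\underline k = (k_\sigma) \in \mathbf{Z}^{\Sigma_F}$ and $\underline t = (t_\sigma) \in \mathbf{R}^{\Sigma_F}$. $G^*$ is the group over $E$ with $G^*(E) = \{g \in \operatorname{GL}_2(F) : \det g \in E^\times\}$. Coordinates: for a real place $\tau$ of $E$, the cocharacter lattice $X_\bullet(\hat T)$ of the standard maximal torus (in the $\tau$-component) is identified with $\{(m_\sigma, n_\sigma)_{\sigma\mid\tau} : m_\sigma, n_\sigma \in \mathbf{Z},\ m_\sigma \equiv n_\sigma \bmod 2\}$, the lattice $X_\bullet(\hat T^*)$ with $\{((m_\sigma)_{\sigma\mid\tau}, n) : m_\sigma, n \in \mathbf{Z},\ n \equiv \sum_\sigma m_\sigma \bmod 2\}$, and the quotient map $X_\bullet(\hat T)\otimes\mathbf{C} \to X_\bullet(\hat T^*)\otimes\mathbf{C}$ is $(m_\sigma, n_\sigma)_{\sigma} \mapsto ((m_\sigma)_\sigma, \sum_\sigma n_\sigma)$. In these coordinates the Harish–Chandra parameter of a Hilbert modular form of weight $(\underline k,\underline t)$ at $\tau$ is $\lambda_\tau = (\pm(k_\sigma - 1), k_\sigma + 2t_\sigma - 2)_{\sigma \mid \tau}$. -}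

module Defs where

open import Level using (Level)
open import Data.Nat using (ℕ; zero; suc)
open import Data.Fin using (Fin; zero; suc)
open import Data.Bool using (Bool; true; false; if_then_else_)
open import Data.Integer as ℤ using (ℤ; +_; -[1+_])
open import Data.Integer.Divisibility using (_∣_)
open import Data.Product using (_×_; Σ; ∃; _,_)
open import Relation.Binary.PropositionalEquality using (_≡_)
open import Algebra.Bundles using (CommutativeRing)


sumℤ : ∀ {d} → (Fin d → ℤ) → ℤ
sumℤ {zero}  f = + 0
sumℤ {suc d} f = f zero ℤ.+ sumℤ (λ i → f (suc i))

signℤ : Bool → ℤ → ℤ
signℤ b x = if b then x else ℤ.- x

-- Everything is parametrised by a commutative ring R playing the role of
-- the real/complex numbers.
module Coeffs {c ℓ : Level} (R : CommutativeRing c ℓ) where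
  open CommutativeRing R using (Carrier; _≈_; _+_; -_; _-_; 0#; 1#)

  natR : ℕ → Carrier
  natR zero    = 0#
  natR (suc n) = 1# + natR n

  ι : ℤ → Carrier
  ι (+ n)      = natR n
  ι -[1+ n ]   = - natR (suc n)

  sumR : ∀ {d} → (Fin d → Carrier) → Carrier
  sumR {zero}  f = 0#
  sumR {suc d} f = f zero + sumR (λ i → f (suc i))

  IsIntegral : Carrier → Set ℓ
  IsIntegral x = Σ ℤ λ j → x ≈ ι j

  -- X_•(T̂) ⊗ C at τ: (m_σ, n_σ)_{σ|τ}
  CocharT : ℕ → Set c
  CocharT d = Fin d → Carrier × Carrier

  -- X_•(T̂*) ⊗ C at τ: ((m_σ)_{σ|τ}, n)
  CocharT* : ℕ → Set c
  CocharT* d = (Fin d → Carrier) × Carrier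

  proj : ∀ {d} → CocharT d → CocharT* d
  proj {d} λv = (λ σ → fst (λv σ)) , sumR (λ σ → snd (λv σ))
    where
    fst : Carrier × Carrier → Carrier
    fst (a , _) = a
    snd : Carrier × Carrier → Carrier
    snd (_ , b) = b

  -- membership in the integral lattice X_•(T̂*) =
  --   {((m_σ), n) : m_σ, n ∈ ℤ, n ≡ Σ m_σ mod 2}
  InLattice* : ∀ {d} → CocharT* d → Set ℓ
  InLattice* {d} (m , n) =
    Σ (Fin d → ℤ) λ M → Σ ℤ λ N →
      ((σ : Fin d) → m σ ≈ ι (M σ)) × (n ≈ ι N) × (+ 2 ∣ (N ℤ.- sumℤ M))

  -- Harish–Chandra parameter at τ of a Hilbert modular form of weight (k,t):
  --   λ_τ = (±(k_σ - 1), k_σ + 2 t_σ - 2)_{σ|τ},  the sign ± chosen by ε σ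
  hcParam : ∀ {d} → (Fin d → ℤ) → (Fin d → Carrier) → (Fin d → Bool) → CocharT d
  hcParam k t ε σ =
    ι (signℤ (ε σ) (k σ ℤ.- + 1)) , (ι (k σ) + (t σ + t σ)) - ι (+ 2)

module Submission where

-- Write the parameter at τ as λ_σ = (s_σ , k_σ + 2 t_σ - 2) with
-- s_σ = ±(k_σ - 1) ∈ ℤ. Its projection is ((s_σ)_σ , n) with
-- n = Σ_σ (k_σ + 2 t_σ - 2). Since ±x ≡ x (mod 2), there are integers g_σ
-- with s_σ + 2 g_σ = k_σ - 1, and then
--     n = Σ s_σ + 2 U,   U = Σ_σ ((t_σ - ½) + g_σ) = T + Σ g_σ,
-- where T = Σ_σ (t_σ - ½). The lattice condition asks for n ∈ ℤ with
-- n ≡ Σ s_σ (mod 2), i.e. U ∈ ℤ, i.e. T ∈ ℤ. Since the coefficient ring R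
-- is arbitrary, "x ∈ ℤ" means "x is the image of an integer"; the argument
-- only uses that the canonical map ι : ℤ → R is additive and that doubling
-- is injective in R (because ½ exists).

open import Defs
open import Level using (Level)
open import Data.Nat using (ℕ; _≤_)
open import Data.Fin using (Fin)
open import Data.Bool using (Bool)
open import Data.Integer using (ℤ)
open import Algebra.Bundles using (CommutativeRing)
open import Function.Bundles using (_⇔_)

import Data.Nat as ℕ
import Data.Fin as F
open import Data.Bool using (true; false)
open import Data.Integer as ℤ using (+_; -[1+_]; _⊖_)
import Data.Integer.Properties as ℤP
import Data.Nat.Properties as ℕP
open import Data.Integer.Divisibility using (_∣_)
open import Data.Integer.Divisibility.Signed using (divides; ∣ᵤ⇒∣; ∣⇒∣ᵤ)
import Data.Integer.Tactic.RingSolver as ℤSolver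
open import Data.Product using (Σ; _,_)
open import Data.Maybe using (nothing)
open import Function.Bundles using (mk⇔)
open import Relation.Binary.PropositionalEquality as P using (_≡_)
import Relation.Binary.Reasoning.Setoid as SetoidReasoning
import Algebra.Properties.Ring as RingProperties
import Algebra.Properties.CommutativeSemigroup as CommutativeSemigroupProperties
open import Tactic.RingSolver.Core.AlmostCommutativeRing using (fromCommutativeRing; AlmostCommutativeRing)
open import Tactic.RingSolver using (solve-∀)

-- The correction g with ±x + 2g = x: it witnesses ±x ≡ x (mod 2).
signGap : Bool → ℤ → ℤ
signGap true  x = + 0
signGap false x = x

sign-plus-gap : ∀ b x → signℤ b x ℤ.+ (signGap b x ℤ.+ signGap b x) ≡ x
sign-plus-gap true  x = ℤP.+-identityʳ x
sign-plus-gap false x = negate-plus-double x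
  where
  negate-plus-double : ∀ x → ℤ.- x ℤ.+ (x ℤ.+ x) ≡ x
  negate-plus-double = ℤSolver.solve-∀

even-difference : ∀ N S → + 2 ∣ (N ℤ.- S) → Σ ℤ λ q → N ≡ S ℤ.+ (q ℤ.+ q)
even-difference N S 2∣N-S with ∣ᵤ⇒∣ 2∣N-S
... | divides q N-S≡2q = q , (begin
  N                         ≡⟨ split N S ⟩
  S ℤ.+ (N ℤ.- S)           ≡⟨ P.cong (λ x → S ℤ.+ x) N-S≡2q ⟩
  S ℤ.+ q ℤ.* + 2           ≡⟨ P.cong (λ x → S ℤ.+ x) (twice q) ⟩
  S ℤ.+ (q ℤ.+ q)           ∎)
  where
  open P.≡-Reasoning
  split : ∀ N S → N ≡ S ℤ.+ (N ℤ.- S)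
  split = ℤSolver.solve-∀
  twice : ∀ q → q ℤ.* + 2 ≡ q ℤ.+ q
  twice = ℤSolver.solve-∀

plus-double-even : ∀ S w → + 2 ∣ ((S ℤ.+ (w ℤ.+ w)) ℤ.- S)
plus-double-even S w = ∣⇒∣ᵤ (divides w (difference S w))
  where
  difference : ∀ S w → (S ℤ.+ (w ℤ.+ w)) ℤ.- S ≡ w ℤ.* + 2
  difference = ℤSolver.solve-∀

-- Ring identities in R, discharged by the ring solver. The solver cannot
-- compare constant coefficients, so repeated variables are kept distinct.
module Identities {c ℓ : Level} (R : CommutativeRing c ℓ) where
  private
    ACR : AlmostCommutativeRing c ℓ
    ACR = fromCommutativeRing R (λ _ → nothing)
  open AlmostCommutativeRing ACR

  cancel-prefix : ∀ o p a b → (o + a) + - (p + b) ≈ (a + - b) + (o + - p)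
  cancel-prefix = solve-∀ ACR

  negate-split : ∀ o x y → - (o + (x + y)) ≈ - (o + x) + - y
  negate-split = solve-∀ ACR

  halve-shift : ∀ K L t t′ h h′ →
    (K + (t + t′)) + - ((h + h′) + L) ≈ (K + - L) + ((t + - h) + (t′ + - h′))
  halve-shift = solve-∀ ACR

  absorb-gap : ∀ s g g′ v v′ → (s + (g + g′)) + (v + v′) ≈ s + ((v + g) + (v′ + g′))
  absorb-gap = solve-∀ ACR

module Embedding {c ℓ : Level} (R : CommutativeRing c ℓ) where
  open CommutativeRing R
  open Coeffs R
  open RingProperties ring using (-0#≈0#; -‿involutive)
  open CommutativeSemigroupProperties +-commutativeSemigroup using (interchange)
  open Identities R
  open SetoidReasoning setoid

  natR-+ : ∀ m n → natR (m ℕ.+ n) ≈ natR m + natR n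
  natR-+ ℕ.zero    n = sym (+-identityˡ _)
  natR-+ (ℕ.suc m) n = trans (+-congˡ (natR-+ m n)) (sym (+-assoc _ _ _))

  ι-⊖ : ∀ m n → ι (m ⊖ n) ≈ natR m - natR n
  ι-⊖ m         ℕ.zero    = sym (trans (+-congˡ -0#≈0#) (+-identityʳ _))
  ι-⊖ ℕ.zero    (ℕ.suc n) = sym (+-identityˡ _)
  ι-⊖ (ℕ.suc m) (ℕ.suc n) = begin
    ι (ℕ.suc m ⊖ ℕ.suc n)          ≡⟨ P.cong ι (ℤP.[1+m]⊖[1+n]≡m⊖n m n) ⟩
    ι (m ⊖ n)                      ≈⟨ ι-⊖ m n ⟩
    natR m - natR n                ≈⟨ +-identityʳ _ ⟨
    (natR m - natR n) + 0#         ≈⟨ +-congˡ (-‿inverseʳ 1#) ⟨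
    (natR m - natR n) + (1# - 1#)  ≈⟨ cancel-prefix 1# 1# (natR m) (natR n) ⟨
    natR (ℕ.suc m) - natR (ℕ.suc n) ∎

  ι-+ : ∀ a b → ι (a ℤ.+ b) ≈ ι a + ι b
  ι-+ (+ m)    (+ n)    = natR-+ m n
  ι-+ (+ m)    -[1+ n ] = ι-⊖ m (ℕ.suc n)
  ι-+ -[1+ m ] (+ n)    = trans (ι-⊖ n (ℕ.suc m)) (+-comm _ _)
  ι-+ -[1+ m ] -[1+ n ] = begin
    - (1# + natR (ℕ.suc (m ℕ.+ n)))   ≡⟨ P.cong (λ x → - (1# + natR x)) (ℕP.+-suc m n) ⟨
    - (1# + natR (m ℕ.+ ℕ.suc n))     ≈⟨ -‿cong (+-congˡ (natR-+ m (ℕ.suc n))) ⟩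
    - (1# + (natR m + natR (ℕ.suc n))) ≈⟨ negate-split 1# (natR m) (natR (ℕ.suc n)) ⟩
    - natR (ℕ.suc m) - natR (ℕ.suc n) ∎

  ι-neg : ∀ a → ι (ℤ.- a) ≈ - ι a
  ι-neg (+ ℕ.zero)  = sym -0#≈0#
  ι-neg (+ ℕ.suc n) = refl
  ι-neg -[1+ n ]    = sym (-‿involutive _)

  ι-sub : ∀ a b → ι (a ℤ.- b) ≈ ι a - ι b
  ι-sub a b = trans (ι-+ a (ℤ.- b)) (+-congˡ (ι-neg b))

  ι-plus-double : ∀ S w → ι (S ℤ.+ (w ℤ.+ w)) ≈ ι S + (ι w + ι w)
  ι-plus-double S w = trans (ι-+ S _) (+-congˡ (ι-+ w w))

  sumR-cong : ∀ {d} {f g : Fin d → Carrier} → (∀ σ → f σ ≈ g σ) → sumR f ≈ sumR g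
  sumR-cong {ℕ.zero}  f≈g = refl
  sumR-cong {ℕ.suc d} f≈g = +-cong (f≈g F.zero) (sumR-cong (λ σ → f≈g (F.suc σ)))

  sumR-+ : ∀ {d} (f g : Fin d → Carrier) → sumR (λ σ → f σ + g σ) ≈ sumR f + sumR g
  sumR-+ {ℕ.zero}  f g = sym (+-identityʳ 0#)
  sumR-+ {ℕ.suc d} f g = trans (+-congˡ (sumR-+ (λ σ → f (F.suc σ)) (λ σ → g (F.suc σ))))
                               (interchange _ _ _ _)

  sumR-ι : ∀ {d} (f : Fin d → ℤ) → sumR (λ σ → ι (f σ)) ≈ ι (sumℤ f)
  sumR-ι {ℕ.zero}  f = refl
  sumR-ι {ℕ.suc d} f = trans (+-congˡ (sumR-ι (λ σ → f (F.suc σ))))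
                             (sym (ι-+ (f F.zero) (sumℤ (λ σ → f (F.suc σ)))))

  -- If ½ exists in R then doubling is injective: A = (A + A) ½.
  double-injective : ∀ {half} → half + half ≈ 1# → ∀ {A B} → A + A ≈ B + B → A ≈ B
  double-injective {half} half-double {A} {B} 2A≈2B = begin
    A                 ≈⟨ *-identityʳ A ⟨
    A * 1#            ≈⟨ *-congˡ half-double ⟨
    A * (half + half) ≈⟨ distribˡ A half half ⟩
    A * half + A * half ≈⟨ distribʳ half A A ⟨
    (A + A) * half    ≈⟨ *-congʳ 2A≈2B ⟩
    (B + B) * half    ≈⟨ distribʳ half B B ⟩
    B * half + B * half ≈⟨ distribˡ B half half ⟨
    B * (half + half) ≈⟨ *-congˡ half-double ⟩
    B * 1#            ≈⟨ *-identityʳ B ⟩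
    B                 ∎

module HarishChandra {c ℓ : Level} (R : CommutativeRing c ℓ)
                     (half : CommutativeRing.Carrier R)
                     (half-double : CommutativeRing._≈_ R
                                      (CommutativeRing._+_ R half half) (CommutativeRing.1# R)) where
  open CommutativeRing R
  open Coeffs R
  open RingProperties ring using (+-cancelˡ; x≈z//y)
  open Identities R
  open Embedding R
  open SetoidReasoning setoid

  module _ {d : ℕ} (k : Fin d → ℤ) (t : Fin d → Carrier) (ε : Fin d → Bool) where

    first : Fin d → ℤ
    first σ = signℤ (ε σ) (k σ ℤ.- + 1)

    gap : Fin d → ℤ
    gap σ = signGap (ε σ) (k σ ℤ.- + 1)

    shifted : Fin d → Carrier
    shifted σ = (t σ - half) + ι (gap σ)

    T U : Carrier
    T = sumR (λ σ → t σ - half)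
    U = sumR shifted

    n : Carrier
    n = sumR (λ σ → (ι (k σ) + (t σ + t σ)) - ι (+ 2))

    coordinate-decomposition : ∀ σ →
      (ι (k σ) + (t σ + t σ)) - ι (+ 2) ≈ ι (first σ) + (shifted σ + shifted σ)
    coordinate-decomposition σ = begin
      (ι (k σ) + (t σ + t σ)) - (1# + ι (+ 1))
        ≈⟨ +-congˡ (-‿cong (+-congʳ half-double)) ⟨
      (ι (k σ) + (t σ + t σ)) - ((half + half) + ι (+ 1))
        ≈⟨ halve-shift (ι (k σ)) (ι (+ 1)) (t σ) (t σ) half half ⟩
      (ι (k σ) - ι (+ 1)) + ((t σ - half) + (t σ - half))
        ≈⟨ +-congʳ (ι-sub (k σ) (+ 1)) ⟨
      ι (k σ ℤ.- + 1) + ((t σ - half) + (t σ - half))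
        ≡⟨ P.cong (λ x → ι x + ((t σ - half) + (t σ - half)))
                  (sign-plus-gap (ε σ) (k σ ℤ.- + 1)) ⟨
      ι (first σ ℤ.+ (gap σ ℤ.+ gap σ)) + ((t σ - half) + (t σ - half))
        ≈⟨ +-congʳ (ι-plus-double (first σ) (gap σ)) ⟩
      (ι (first σ) + (ι (gap σ) + ι (gap σ))) + ((t σ - half) + (t σ - half))
        ≈⟨ absorb-gap _ _ _ _ _ ⟩
      ι (first σ) + (shifted σ + shifted σ) ∎

    n-decomposition : n ≈ ι (sumℤ first) + (U + U)
    n-decomposition = begin
      n                                                  ≈⟨ sumR-cong coordinate-decomposition ⟩
      sumR (λ σ → ι (first σ) + (shifted σ + shifted σ))
        ≈⟨ sumR-+ (λ σ → ι (first σ)) (λ σ → shifted σ + shifted σ) ⟩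
      sumR (λ σ → ι (first σ)) + sumR (λ σ → shifted σ + shifted σ)
        ≈⟨ +-cong (sumR-ι first) (sumR-+ shifted shifted) ⟩
      ι (sumℤ first) + (U + U)                           ∎

    U-decomposition : T + ι (sumℤ gap) ≈ U
    U-decomposition = sym (trans (sumR-+ (λ σ → t σ - half) (λ σ → ι (gap σ))) (+-congˡ (sumR-ι gap)))

    -- If n ∈ ℤ with n ≡ Σ s_σ (mod 2), then 2U = 2q for an integer q, so
    -- U = q and T = q - Σ g_σ.
    lattice⇒integral : InLattice* (proj (hcParam k t ε)) → IsIntegral T
    lattice⇒integral (M , N , first≈M , n≈N , N≡ΣM) with even-difference N (sumℤ M) N≡ΣM
    ... | q , N≡ΣM+2q = q ℤ.- sumℤ gap , (begin
      T                  ≈⟨ x≈z//y T _ U U-decomposition ⟩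
      U - ι (sumℤ gap)   ≈⟨ +-congʳ U≈q ⟩
      ι q - ι (sumℤ gap) ≈⟨ ι-sub q (sumℤ gap) ⟨
      ι (q ℤ.- sumℤ gap) ∎)
      where
      ΣM≈Σfirst : ι (sumℤ M) ≈ ι (sumℤ first)
      ΣM≈Σfirst = trans (sym (sumR-ι M)) (trans (sumR-cong (λ σ → sym (first≈M σ))) (sumR-ι first))
      2U≈2q : ι (sumℤ first) + (U + U) ≈ ι (sumℤ first) + (ι q + ι q)
      2U≈2q = begin
        ι (sumℤ first) + (U + U)   ≈⟨ n-decomposition ⟨
        n                          ≈⟨ n≈N ⟩
        ι N                        ≡⟨ P.cong ι N≡ΣM+2q ⟩
        ι (sumℤ M ℤ.+ (q ℤ.+ q))   ≈⟨ ι-plus-double (sumℤ M) q ⟩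
        ι (sumℤ M) + (ι q + ι q)   ≈⟨ +-congʳ ΣM≈Σfirst ⟩
        ι (sumℤ first) + (ι q + ι q) ∎
      U≈q : U ≈ ι q
      U≈q = double-injective half-double (+-cancelˡ _ _ _ 2U≈2q)

    -- If T = j ∈ ℤ then U = j + Σ g_σ, and n = Σ s_σ + 2U is the required
    -- integer congruent to Σ s_σ (mod 2).
    integral⇒lattice : IsIntegral T → InLattice* (proj (hcParam k t ε))
    integral⇒lattice (j , T≈j) =
      first , sumℤ first ℤ.+ (w ℤ.+ w) , (λ σ → refl) , n≈N , plus-double-even (sumℤ first) w
      where
      w : ℤ
      w = j ℤ.+ sumℤ gap
      U≈w : U ≈ ι w
      U≈w = begin
        U                   ≈⟨ U-decomposition ⟨
        T + ι (sumℤ gap)    ≈⟨ +-congʳ T≈j ⟩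
        ι j + ι (sumℤ gap)  ≈⟨ ι-+ j (sumℤ gap) ⟨
        ι w                 ∎
      n≈N : n ≈ ι (sumℤ first ℤ.+ (w ℤ.+ w))
      n≈N = begin
        n                            ≈⟨ n-decomposition ⟩
        ι (sumℤ first) + (U + U)     ≈⟨ +-congˡ (+-cong U≈w U≈w) ⟩
        ι (sumℤ first) + (ι w + ι w) ≈⟨ ι-plus-double (sumℤ first) w ⟨
        ι (sumℤ first ℤ.+ (w ℤ.+ w)) ∎

proposition2p10 : ∀ {c ℓ : Level} (R : CommutativeRing c ℓ)
    → let open CommutativeRing R
          open Coeffs R
      in (half : Carrier) → half + half ≈ 1#
    → (d : ℕ) → 1 ≤ d
    → (k : Fin d → ℤ) (t : Fin d → Carrier) (ε : Fin d → Bool)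
    → InLattice* (proj (hcParam k t ε)) ⇔ IsIntegral (sumR (λ σ → t σ - half))
proposition2p10 R half half-double d _ k t ε =
  mk⇔ (lattice⇒integral k t ε) (integral⇒lattice k t ε)
  where open HarishChandra R half half-double
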